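{- The following two statements are equivalent. (i) For every $m,n\ge1$ and every reduced union-closed matrix $F\in\mathbb{Q}^{m\times n}$, there is $r\in\mathbb{N}$ such that $2\,\Sigma[F\,w_r(F)]\ge m$. (ii) For every nonempty finite set $S$ and every reduced union-closed family $\mathcal{F}$ on $S$, there is $r\in\mathbb{N}$ such that $$2\,\frac{\sum_{\mathcal{A}\in\mathcal{F}^{r+1}}\left|\bigcap\mathcal{A}\right|}{|\mathcal{F}|^{r+1}}\ \ge\ \frac{\sum_{\mathcal{A}\in\mathcal{F}^{r}}\left|\bigcap\mathcal{A}\right|}{|\mathcal{F}|^{r}},$$ where $\mathcal{F}^r$ is the set of ordered $r$-tuples of members of $\mathcal{F}$ and $\bigcap\mathcal{A}$ is the intersection of the members of the tuple $\mathcal{A}$ (with the convention that the intersection of the empty tuple is $S$).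
   Context: A reduced union-closed family on a nonempty finite set $S$ is a family $\mathcal{F}$ of subsets of $S$ such that $\varnothing,S\in\mathcal{F}$, for every $x\in S$ there are $A,B\in\mathcal{F}$ with $A\setminus B=\{x\}$, and $A\cup B\in\mathcal{F}$ for all $A,B\in\mathcal{F}$. A matrix $F\in\mathbb{Q}^{m\times n}$ is a reduced union-closed matrix if it is the characteristic matrix of a reduced union-closed family $\{A_1,\dots,A_m\}$ on $S=\{x_1,\dots,x_n\}$, i.e. $F(h,k)=1$ if $x_k\in A_h$ and $F(h,k)=0$ otherwise. Here $e_k$ is the $k$-th unit coordinate vector, $\Sigma v$ denotes the sum of the entries of a vector $v$, and for $r\in\mathbb{N}$, $w_r(F)\in\mathbb{Q}^n$ has components $[w_r(F)]_k=(\Sigma[Fe_k])^r/\sum_{i=1}^n(\Sigma[Fe_i])^r$. -}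

module Defs where

open import Data.Nat as ℕ using (ℕ; zero; suc)
open import Data.Integer using (+_)
open import Data.Rational using (ℚ; 0ℚ; 1ℚ; _+_; _*_; _÷_; ≢-nonZero)
open import Data.Rational.Properties using (_≟_)
open import Data.Fin using (Fin)
open import Data.Fin.Subset using (Subset; _∈_; _∪_; _∩_; ∁; ⁅_⁆; ⊤; ⊥; ∣_∣)
import Data.Nat.ListAction
open import Data.List as List using (List; []; _∷_; length)
open import Data.List.Membership.Propositional as LM using ()
open import Data.List.Relation.Unary.Unique.Propositional using (Unique)
open import Data.Vec as Vec using (Vec; lookup)
open import Data.Vec.Functional using (toList)
open import Data.Product using (Σ; ∃; _×_; _,_)
open import Data.Bool using (if_then_else_)
open import Relation.Nullary using (yes; no)
open import Relation.Binary.PropositionalEquality using (_≡_)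

ℕtoℚ : ℕ → ℚ
ℕtoℚ k = + k Data.Rational./ 1

_^ℚ_ : ℚ → ℕ → ℚ
p ^ℚ zero  = 1ℚ
p ^ℚ suc r = p * (p ^ℚ r)

-- division made total (value 0 on a zero denominator); in every use
-- below the denominator is nonzero under the hypotheses.
_÷'_ : ℚ → ℚ → ℚ
p ÷' q with q ≟ 0ℚ
... | yes _  = 0ℚ
... | no q≢0 = _÷_ p q {{≢-nonZero q≢0}}

Σℚ : ∀ {n} → (Fin n → ℚ) → ℚ
Σℚ {zero}  v = 0ℚ
Σℚ {suc n} v = v Fin.zero + Σℚ (λ i → v (Fin.suc i))
  where import Data.Fin as Fin

sumℕ : List ℕ → ℕ
sumℕ = Data.Nat.ListAction.sum

_∈F_ : ∀ {n} → Subset n → List (Subset n) → Set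
A ∈F 𝓕 = A LM.∈ 𝓕

record IsReducedUnionClosed {n : ℕ} (𝓕 : List (Subset n)) : Set where
  field
    distinct    : Unique 𝓕
    empty∈      : ⊥ ∈F 𝓕
    full∈       : ⊤ ∈F 𝓕
    separating  : ∀ (x : Fin n) →
                  ∃ λ A → ∃ λ B → A ∈F 𝓕 × B ∈F 𝓕 × (A ∩ ∁ B ≡ ⁅ x ⁆)
    unionClosed : ∀ A B → A ∈F 𝓕 → B ∈F 𝓕 → (A ∪ B) ∈F 𝓕

Matrix : ℕ → ℕ → Set
Matrix m n = Fin m → Fin n → ℚ

charMatrix : ∀ {m n} → (Fin m → Subset n) → Matrix m n
charMatrix A h k = if lookup (A h) k then 1ℚ else 0ℚ

IsReducedUnionClosedMatrix : ∀ {m n} → Matrix m n → Set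
IsReducedUnionClosedMatrix {m} {n} F =
  Σ (Fin m → Subset n) λ A →
    IsReducedUnionClosed (toList A) × (∀ h k → F h k ≡ charMatrix A h k)

_·_ : ∀ {m n} → Matrix m n → (Fin n → ℚ) → (Fin m → ℚ)
(F · v) h = Σℚ (λ k → F h k * v k)

colSum : ∀ {m n} → Matrix m n → Fin n → ℚ
colSum F k = Σℚ (λ h → F h k)

w : ∀ {m n} → ℕ → Matrix m n → (Fin n → ℚ)
w r F k = (colSum F k ^ℚ r) ÷' Σℚ (λ i → colSum F i ^ℚ r)

tuples : ∀ {A : Set} → List A → (r : ℕ) → List (Vec A r)
tuples xs zero    = Vec.[] ∷ []
tuples xs (suc r) = List.concatMap (λ x → List.map (x Vec.∷_) (tuples xs r)) xs

⋂ : ∀ {n r} → Vec (Subset n) r → Subset n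
⋂ = Vec.foldr _ _∩_ ⊤

intersectionSum : ∀ {n} → List (Subset n) → ℕ → ℕ
intersectionSum 𝓕 r = sumℕ (List.map (λ 𝓐 → ∣ ⋂ 𝓐 ∣) (tuples 𝓕 r))

avgIntersection : ∀ {n} → List (Subset n) → ℕ → ℚ
avgIntersection 𝓕 r =
  ℕtoℚ (intersectionSum 𝓕 r) ÷' (ℕtoℚ (length 𝓕) ^ℚ r)

StatementI : Set
StatementI =
  ∀ (m n : ℕ) → 1 ℕ.≤ m → 1 ℕ.≤ n → (F : Matrix m n) →
  IsReducedUnionClosedMatrix F →
  ∃ λ (r : ℕ) → ℕtoℚ m Data.Rational.≤ ℕtoℚ 2 * Σℚ (F · w r F)

StatementII : Set
StatementII =
  ∀ (n : ℕ) → 1 ℕ.≤ n → (𝓕 : List (Subset n)) →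
  IsReducedUnionClosed 𝓕 →
  ∃ λ (r : ℕ) →
    avgIntersection 𝓕 r Data.Rational.≤ ℕtoℚ 2 * avgIntersection 𝓕 (suc r)

module Submission where

-- Both statements reduce to one inequality between natural numbers.
-- List a reduced union-closed family as A : Fin m → Subset n, let
-- deg k = |{h : x_k ∈ A_h}| (the k-th column sum of its characteristic
-- matrix F) and let P r = Σ_k (deg k)^r be the r-th degree power sum.
--   * Family side: an r-fold intersection contains x_k iff every member
--     of the tuple does, so Σ_{𝓐 ∈ 𝓕^r} |⋂ 𝓐| = Σ_k (deg k)^r = P r and
--     the r-th average intersection size equals P r / m^r.
--   * Matrix side: w_r(F)_k = (deg k)^r / P r, hence
--     Σ[F w_r(F)] = Σ_k deg k · (deg k)^r / P r = P (r+1) / P r.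
-- Since S ∈ 𝓕, every degree is at least 1, so m ≥ 1 and P r ≥ 1; after
-- clearing these positive denominators both inequalities, for the same
-- r, say exactly  m · P r ≤ 2 · P (r+1).

open import Defs
open import Data.Nat as ℕ using (ℕ; zero; suc; _≤_; _^_; z≤n; s≤s)
import Data.Nat.Properties as NP
import Algebra.Properties.Semiring.Sum as SemiringSum
open import Data.Integer as ℤ using (+_)
import Data.Integer.Properties as ZP
open import Data.Rational as Q using (ℚ; 0ℚ; 1ℚ; _+_; _*_; toℚᵘ)
import Data.Rational.Properties as QP
import Data.Rational.Unnormalised as U
import Data.Rational.Unnormalised.Properties as UP
open import Data.Nat.Coprimality as C using (1-coprimeTo)
open import Data.Bool using (Bool; true; false; _∧_; if_then_else_)
open import Data.Fin using (Fin; zero; suc; fromℕ<)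
open import Data.Fin.Subset using (Subset; _∩_; ⊤; ∣_∣)
open import Data.List as List using (List; []; _∷_; map; length)
import Data.List.Properties as LP
import Data.Nat.ListAction.Properties as ListSum
open import Data.List.Membership.Propositional.Properties using (∈-tabulate⁻)
open import Data.Vec as Vec using (Vec; lookup)
import Data.Vec.Properties as VP
open import Data.Vec.Functional using (toList)
open import Data.Product using (_×_; _,_; proj₁; proj₂)
open import Data.Empty using (⊥-elim)
open import Function.Bundles using (_⇔_; mk⇔; Equivalence)
open import Relation.Nullary using (yes; no)
open import Relation.Binary.PropositionalEquality
open ≡-Reasoning

module ΣN = SemiringSum NP.+-*-semiring

ι : ℕ → ℚ
ι = ℕtoℚ

toℚᵘ-ι : ∀ k → toℚᵘ (ι k) ≡ U.mkℚᵘ (+ k) 0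
toℚᵘ-ι k = cong toℚᵘ (QP.normalize-coprime (C.sym (1-coprimeTo k)))

≡ι : ∀ p a → toℚᵘ p U.≃ U.mkℚᵘ (+ a) 0 → p ≡ ι a
≡ι p a eq = QP.toℚᵘ-injective (UP.≃-trans eq (UP.≃-reflexive (sym (toℚᵘ-ι a))))

ι-+ : ∀ a b → ι a + ι b ≡ ι (a ℕ.+ b)
ι-+ a b = ≡ι (ι a + ι b) (a ℕ.+ b) (UP.≃-trans (QP.toℚᵘ-homo-+ (ι a) (ι b))
  (UP.≃-trans (UP.≃-reflexive (cong₂ U._+_ (toℚᵘ-ι a) (toℚᵘ-ι b))) (U.*≡* (begin
    (+ a ℤ.* + 1 ℤ.+ + b ℤ.* + 1) ℤ.* + 1
      ≡⟨ ZP.*-identityʳ _ ⟩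
    + a ℤ.* + 1 ℤ.+ + b ℤ.* + 1
      ≡⟨ cong₂ ℤ._+_ (ZP.*-identityʳ (+ a)) (ZP.*-identityʳ (+ b)) ⟩
    + a ℤ.+ + b
      ≡⟨ ZP.pos-+ a b ⟨
    + (a ℕ.+ b)
      ≡⟨ ZP.*-identityʳ _ ⟨
    + (a ℕ.+ b) ℤ.* + 1 ∎))))

ι-* : ∀ a b → ι a * ι b ≡ ι (a ℕ.* b)
ι-* a b = ≡ι (ι a * ι b) (a ℕ.* b) (UP.≃-trans (QP.toℚᵘ-homo-* (ι a) (ι b))
  (UP.≃-trans (UP.≃-reflexive (cong₂ U._*_ (toℚᵘ-ι a) (toℚᵘ-ι b)))
    (U.*≡* (cong (ℤ._* + 1) (sym (ZP.pos-* a b))))))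

ι-^ : ∀ a r → ι a ^ℚ r ≡ ι (a ^ r)
ι-^ a zero    = refl
ι-^ a (suc r) = trans (cong (ι a *_) (ι-^ a r)) (ι-* a (a ^ r))

ι-mono-≤ : ∀ {a b} → a ≤ b → ι a Q.≤ ι b
ι-mono-≤ {a} {b} a≤b = QP.toℚᵘ-cancel-≤ (subst₂ U._≤_ (sym (toℚᵘ-ι a)) (sym (toℚᵘ-ι b))
  (U.*≤* (subst₂ ℤ._≤_ (sym (ZP.*-identityʳ (+ a))) (sym (ZP.*-identityʳ (+ b))) (ℤ.+≤+ a≤b))))

ι-cancel-≤ : ∀ {a b} → ι a Q.≤ ι b → a ≤ b
ι-cancel-≤ {a} {b} le = ZP.drop‿+≤+ (subst₂ ℤ._≤_ (ZP.*-identityʳ (+ a)) (ZP.*-identityʳ (+ b))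
  (UP.drop-*≤* (subst₂ U._≤_ (toℚᵘ-ι a) (toℚᵘ-ι b) (QP.toℚᵘ-mono-≤ le))))

ι-positive : ∀ d → Q.Positive (ι (suc d))
ι-positive d = QP.normalize-pos (suc d) 1

ι-≢0 : ∀ {D} → 1 ≤ D → ι D ≢ 0ℚ
ι-≢0 {suc d} _ e with ι-cancel-≤ {suc d} {0} (subst (ι (suc d) Q.≤_) e QP.≤-refl)
... | ()

÷'-cancel : ∀ p q → q ≢ 0ℚ → (p ÷' q) * q ≡ p
÷'-cancel p q q≢0 with q QP.≟ 0ℚ
... | yes q≡0 = ⊥-elim (q≢0 q≡0)
... | no  q≢0' = let instance _ = Q.≢-nonZero q≢0' in begin
  p * Q.1/ q * q    ≡⟨ QP.*-assoc p (Q.1/ q) q ⟩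
  p * (Q.1/ q * q)  ≡⟨ cong (p *_) (QP.*-inverseˡ q) ⟩
  p * 1ℚ            ≡⟨ QP.*-identityʳ p ⟩
  p                 ∎

clear-denominator : ∀ {x y} D {u v} → 1 ≤ D →
  x * ι D ≡ ι u → y * ι D ≡ ι v → (x Q.≤ y) ⇔ (u ≤ v)
clear-denominator {x} {y} (suc d) _ xD≡u yD≡v = mk⇔
  (λ x≤y → ι-cancel-≤ (subst₂ Q._≤_ xD≡u yD≡v (QP.*-monoʳ-≤-nonNeg (ι (suc d)) x≤y)))
  (λ u≤v → QP.*-cancelʳ-≤-pos (ι (suc d)) (subst₂ Q._≤_ (sym xD≡u) (sym yD≡v) (ι-mono-≤ u≤v)))
  where
  instance
    D-pos : Q.Positive (ι (suc d))
    D-pos = ι-positive d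
    D-nonNeg : Q.NonNegative (ι (suc d))
    D-nonNeg = QP.pos⇒nonNeg (ι (suc d))

clear-scaled : ∀ c {x D u} → x * ι D ≡ ι u → (ι c * x) * ι D ≡ ι (c ℕ.* u)
clear-scaled c {x} {D} {u} xD≡u = begin
  ι c * x * ι D    ≡⟨ QP.*-assoc (ι c) x (ι D) ⟩
  ι c * (x * ι D)  ≡⟨ cong (ι c *_) xD≡u ⟩
  ι c * ι u        ≡⟨ ι-* c u ⟩
  ι (c ℕ.* u)      ∎

term≤sum : ∀ {n} (f : Fin n → ℕ) i → f i ≤ ΣN.sum f
term≤sum f zero    = NP.m≤m+n _ _
term≤sum f (suc i) = NP.≤-trans (term≤sum (λ j → f (suc j)) i) (NP.m≤n+m _ (f zero))

Σℚ-cong : ∀ {n} {f g : Fin n → ℚ} → (∀ i → f i ≡ g i) → Σℚ f ≡ Σℚ g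
Σℚ-cong {zero}  e = refl
Σℚ-cong {suc n} e = cong₂ _+_ (e zero) (Σℚ-cong (λ i → e (suc i)))

Σℚ-ι : ∀ {n} (f : Fin n → ℕ) → Σℚ (λ i → ι (f i)) ≡ ι (ΣN.sum f)
Σℚ-ι {zero}  f = refl
Σℚ-ι {suc n} f = trans (cong (λ s → ι (f zero) + s) (Σℚ-ι (λ i → f (suc i))))
                       (ι-+ (f zero) (ΣN.sum (λ i → f (suc i))))

Σℚ-*ʳ : ∀ {n} (f : Fin n → ℚ) a → Σℚ f * a ≡ Σℚ (λ i → f i * a)
Σℚ-*ʳ {zero}  f a = QP.*-zeroˡ a
Σℚ-*ʳ {suc n} f a = trans (QP.*-distribʳ-+ a (f zero) _)
                          (cong (λ s → f zero * a + s) (Σℚ-*ʳ (λ i → f (suc i)) a))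

sumList-concatMap : ∀ {A B : Set} (g : B → ℕ) (f : A → List B) xs →
  sumℕ (map g (List.concatMap f xs)) ≡ sumℕ (map (λ x → sumℕ (map g (f x))) xs)
sumList-concatMap g f []       = refl
sumList-concatMap g f (x ∷ xs) = begin
  sumℕ (map g (f x List.++ List.concatMap f xs))
    ≡⟨ cong sumℕ (LP.map-++ g (f x) (List.concatMap f xs)) ⟩
  sumℕ (map g (f x) List.++ map g (List.concatMap f xs))
    ≡⟨ ListSum.sum-++ (map g (f x)) _ ⟩
  sumℕ (map g (f x)) ℕ.+ sumℕ (map g (List.concatMap f xs))
    ≡⟨ cong (sumℕ (map g (f x)) ℕ.+_) (sumList-concatMap g f xs) ⟩
  sumℕ (map g (f x)) ℕ.+ sumℕ (map (λ x → sumℕ (map g (f x))) xs) ∎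

sumList-*ˡ : ∀ {A : Set} a (h : A → ℕ) xs →
  sumℕ (map (λ t → a ℕ.* h t) xs) ≡ a ℕ.* sumℕ (map h xs)
sumList-*ˡ a h []       = sym (NP.*-zeroʳ a)
sumList-*ˡ a h (x ∷ xs) = trans (cong (a ℕ.* h x ℕ.+_) (sumList-*ˡ a h xs))
                                (sym (NP.*-distribˡ-+ a (h x) _))

sumList-*ʳ : ∀ {A : Set} a (h : A → ℕ) xs →
  sumℕ (map (λ t → h t ℕ.* a) xs) ≡ sumℕ (map h xs) ℕ.* a
sumList-*ʳ a h []       = refl
sumList-*ʳ a h (x ∷ xs) = trans (cong (h x ℕ.* a ℕ.+_) (sumList-*ʳ a h xs))
                                (sym (NP.*-distribʳ-+ a (h x) _))

sumList-∑-comm : ∀ {A : Set} {n} (g : A → Fin n → ℕ) xs →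
  sumℕ (map (λ t → ΣN.sum (g t)) xs) ≡ ΣN.sum (λ k → sumℕ (map (λ t → g t k) xs))
sumList-∑-comm {n = n} g [] = sym (ΣN.sum-replicate-zero n)
sumList-∑-comm g (x ∷ xs) =
  trans (cong (ΣN.sum (g x) ℕ.+_) (sumList-∑-comm g xs))
        (sym (ΣN.∑-distrib-+ (g x) (λ k → sumℕ (map (λ t → g t k) xs))))

sumList-toList : ∀ {A : Set} {m} (g : A → ℕ) (f : Fin m → A) →
  sumℕ (map g (toList f)) ≡ ΣN.sum (λ h → g (f h))
sumList-toList {m = zero}  g f = refl
sumList-toList {m = suc m} g f = cong (g (f zero) ℕ.+_) (sumList-toList g (λ h → f (suc h)))

∏ : ∀ {r} → Vec ℕ r → ℕ
∏ = Vec.foldr _ ℕ._*_ 1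

sum-tuples-∏ : ∀ {A : Set} (g : A → ℕ) xs r →
  sumℕ (map (λ t → ∏ (Vec.map g t)) (tuples xs r)) ≡ sumℕ (map g xs) ^ r
sum-tuples-∏ g xs zero    = refl
sum-tuples-∏ g xs (suc r) = begin
  sumℕ (map weight (List.concatMap (λ x → map (x Vec.∷_) (tuples xs r)) xs))
    ≡⟨ sumList-concatMap weight _ xs ⟩
  sumℕ (map (λ x → sumℕ (map weight (map (x Vec.∷_) (tuples xs r)))) xs)
    ≡⟨ cong sumℕ (LP.map-cong extend xs) ⟩
  sumℕ (map (λ x → g x ℕ.* sumℕ (map g xs) ^ r) xs)
    ≡⟨ sumList-*ʳ (sumℕ (map g xs) ^ r) g xs ⟩
  sumℕ (map g xs) ℕ.* sumℕ (map g xs) ^ r ∎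
  where
  weight : ∀ {r} → Vec _ r → ℕ
  weight t = ∏ (Vec.map g t)
  -- prepending x multiplies every weight by g x
  extend : ∀ x → sumℕ (map weight (map (x Vec.∷_) (tuples xs r))) ≡ g x ℕ.* sumℕ (map g xs) ^ r
  extend x = begin
    sumℕ (map weight (map (x Vec.∷_) (tuples xs r)))
      ≡⟨ cong sumℕ (LP.map-∘ (tuples xs r)) ⟨
    sumℕ (map (λ t → g x ℕ.* weight t) (tuples xs r))
      ≡⟨ sumList-*ˡ (g x) weight (tuples xs r) ⟩
    g x ℕ.* sumℕ (map weight (tuples xs r))
      ≡⟨ cong (g x ℕ.*_) (sum-tuples-∏ g xs r) ⟩
    g x ℕ.* sumℕ (map g xs) ^ r ∎

bit : Bool → ℕ
bit true  = 1
bit false = 0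

𝟙 : ∀ {n} → Subset n → Fin n → ℕ
𝟙 S k = bit (lookup S k)

𝟙-⊤ : ∀ {n} (k : Fin n) → 𝟙 ⊤ k ≡ 1
𝟙-⊤ k = cong bit (VP.lookup-replicate k true)

∣∣-as-sum : ∀ {n} (S : Subset n) → ∣ S ∣ ≡ ΣN.sum (𝟙 S)
∣∣-as-sum Vec.[]          = refl
∣∣-as-sum (true  Vec.∷ S) = cong suc (∣∣-as-sum S)
∣∣-as-sum (false Vec.∷ S) = ∣∣-as-sum S

𝟙-⋂ : ∀ {n r} (t : Vec (Subset n) r) k → 𝟙 (⋂ t) k ≡ ∏ (Vec.map (λ S → 𝟙 S k) t)
𝟙-⋂ Vec.[]       k = 𝟙-⊤ k
𝟙-⋂ (S Vec.∷ t) k = begin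
  bit (lookup (S ∩ ⋂ t) k)               ≡⟨ cong bit (VP.lookup-zipWith _∧_ k S (⋂ t)) ⟩
  bit (lookup S k ∧ lookup (⋂ t) k)      ≡⟨ bit-∧ (lookup S k) (lookup (⋂ t) k) ⟩
  𝟙 S k ℕ.* 𝟙 (⋂ t) k                    ≡⟨ cong (𝟙 S k ℕ.*_) (𝟙-⋂ t k) ⟩
  𝟙 S k ℕ.* ∏ (Vec.map (λ S → 𝟙 S k) t)  ∎
  where
  bit-∧ : ∀ a b → bit (a ∧ b) ≡ bit a ℕ.* bit b
  bit-∧ true  b = sym (NP.+-identityʳ (bit b))
  bit-∧ false b = refl

intersectionSum-as-powers : ∀ {n} (𝓕 : List (Subset n)) r →
  intersectionSum 𝓕 r ≡ ΣN.sum (λ k → sumℕ (map (λ S → 𝟙 S k) 𝓕) ^ r)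
intersectionSum-as-powers 𝓕 r = begin
  sumℕ (map (λ t → ∣ ⋂ t ∣) (tuples 𝓕 r))
    ≡⟨ cong sumℕ (LP.map-cong (λ t → ∣∣-as-sum (⋂ t)) (tuples 𝓕 r)) ⟩
  sumℕ (map (λ t → ΣN.sum (𝟙 (⋂ t))) (tuples 𝓕 r))
    ≡⟨ sumList-∑-comm (λ t → 𝟙 (⋂ t)) (tuples 𝓕 r) ⟩
  ΣN.sum (λ k → sumℕ (map (λ t → 𝟙 (⋂ t) k) (tuples 𝓕 r)))
    ≡⟨ ΣN.sum-cong-≗ (λ k → trans (cong sumℕ (LP.map-cong (λ t → 𝟙-⋂ t k) (tuples 𝓕 r)))
                                  (sum-tuples-∏ (λ S → 𝟙 S k) 𝓕 r)) ⟩
  ΣN.sum (λ k → sumℕ (map (λ S → 𝟙 S k) 𝓕) ^ r) ∎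

deg : ∀ {m n} → (Fin m → Subset n) → Fin n → ℕ
deg A k = ΣN.sum (λ h → 𝟙 (A h) k)

powerSum : ∀ {m n} → (Fin m → Subset n) → ℕ → ℕ
powerSum A r = ΣN.sum (λ k → deg A k ^ r)

intersectionSum-powerSum : ∀ {m n} (A : Fin m → Subset n) r →
  intersectionSum (toList A) r ≡ powerSum A r
intersectionSum-powerSum A r = trans (intersectionSum-as-powers (toList A) r)
  (ΣN.sum-cong-≗ (λ k → cong (_^ r) (sumList-toList (λ S → 𝟙 S k) A)))

module Positivity {m n} (A : Fin m → Subset n) (full : ⊤ ∈F toList A) where

  full-row : Fin m
  full-row = proj₁ (∈-tabulate⁻ full)

  rows-positive : 1 ≤ m
  rows-positive with full-row
  ... | zero  = s≤s z≤n
  ... | suc _ = s≤s z≤n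

  deg-positive : ∀ k → 1 ≤ deg A k
  deg-positive k = subst (_≤ deg A k)
    (trans (cong (λ S → 𝟙 S k) (sym (proj₂ (∈-tabulate⁻ full)))) (𝟙-⊤ k))
    (term≤sum (λ h → 𝟙 (A h) k) full-row)

  powerSum-positive : 1 ≤ n → ∀ r → 1 ≤ powerSum A r
  powerSum-positive n≥1 r = NP.≤-trans
    (NP.m^n>0 (deg A k) {{ℕ.>-nonZero (deg-positive k)}} r) (term≤sum (λ k → deg A k ^ r) k)
    where
    k : Fin n
    k = fromℕ< n≥1

avgIntersection-cleared : ∀ {m n} (A : Fin m → Subset n) r → 1 ≤ m →
  avgIntersection (toList A) r * ι (m ^ r) ≡ ι (powerSum A r)
avgIntersection-cleared {m} A r m≥1 = begin
  avgIntersection (toList A) r * ι (m ^ r)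
    ≡⟨ cong (avgIntersection (toList A) r *_) (sym denominator) ⟩
  ι (intersectionSum (toList A) r) ÷' (ι (length (toList A)) ^ℚ r) * (ι (length (toList A)) ^ℚ r)
    ≡⟨ ÷'-cancel _ _ (λ e → ι-≢0 (NP.m^n>0 m {{ℕ.>-nonZero m≥1}} r) (trans (sym denominator) e)) ⟩
  ι (intersectionSum (toList A) r)
    ≡⟨ cong ι (intersectionSum-powerSum A r) ⟩
  ι (powerSum A r) ∎
  where
  denominator : ι (length (toList A)) ^ℚ r ≡ ι (m ^ r)
  denominator = trans (cong (λ l → ι l ^ℚ r) (LP.length-tabulate A)) (ι-^ m r)

module CharacteristicMatrix {m n} (A : Fin m → Subset n) (F : Matrix m n)
  (F≡χ : ∀ h k → F h k ≡ charMatrix A h k) where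

  entry : ∀ h k → F h k ≡ ι (𝟙 (A h) k)
  entry h k = trans (F≡χ h k) (χ≡bit (lookup (A h) k))
    where
    χ≡bit : ∀ b → (if b then 1ℚ else 0ℚ) ≡ ι (bit b)
    χ≡bit true  = refl
    χ≡bit false = refl

  colSum-deg : ∀ k → colSum F k ≡ ι (deg A k)
  colSum-deg k = trans (Σℚ-cong (λ h → entry h k)) (Σℚ-ι (λ h → 𝟙 (A h) k))

  w-cleared : ∀ r → 1 ≤ powerSum A r → ∀ k → w r F k * ι (powerSum A r) ≡ ι (deg A k ^ r)
  w-cleared r P≥1 k = begin
    w r F k * ι (powerSum A r)
      ≡⟨ cong (_* ι (powerSum A r)) (cong₂ _÷'_ numerator denominator) ⟩
    ι (deg A k ^ r) ÷' ι (powerSum A r) * ι (powerSum A r)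
      ≡⟨ ÷'-cancel _ _ (ι-≢0 P≥1) ⟩
    ι (deg A k ^ r) ∎
    where
    power : ∀ i → colSum F i ^ℚ r ≡ ι (deg A i ^ r)
    power i = trans (cong (_^ℚ r) (colSum-deg i)) (ι-^ (deg A i) r)
    numerator = power k
    denominator = trans (Σℚ-cong power) (Σℚ-ι (λ i → deg A i ^ r))

  -- Σ[F w_r(F)] · P r = Σ_h Σ_k 𝟙(A h) k · (deg k)^r = Σ_k (deg k)^(r+1)
  mass-cleared : ∀ r → 1 ≤ powerSum A r → Σℚ (F · w r F) * ι (powerSum A r) ≡ ι (powerSum A (suc r))
  mass-cleared r P≥1 = begin
    Σℚ (F · w r F) * ι (powerSum A r)
      ≡⟨ Σℚ-*ʳ (F · w r F) (ι (powerSum A r)) ⟩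
    Σℚ (λ h → (F · w r F) h * ι (powerSum A r))
      ≡⟨ Σℚ-cong row ⟩
    Σℚ (λ h → ι (ΣN.sum (λ k → 𝟙 (A h) k ℕ.* deg A k ^ r)))
      ≡⟨ Σℚ-ι (λ h → ΣN.sum (λ k → 𝟙 (A h) k ℕ.* deg A k ^ r)) ⟩
    ι (ΣN.sum (λ h → ΣN.sum (λ k → 𝟙 (A h) k ℕ.* deg A k ^ r)))
      ≡⟨ cong ι (ΣN.∑-comm (λ h k → 𝟙 (A h) k ℕ.* deg A k ^ r)) ⟩
    ι (ΣN.sum (λ k → ΣN.sum (λ h → 𝟙 (A h) k ℕ.* deg A k ^ r)))
      ≡⟨ cong ι (ΣN.sum-cong-≗ (λ k → sym (ΣN.*-distribʳ-sum (deg A k ^ r) (λ h → 𝟙 (A h) k)))) ⟩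
    ι (powerSum A (suc r)) ∎
    where
    row : ∀ h → (F · w r F) h * ι (powerSum A r) ≡ ι (ΣN.sum (λ k → 𝟙 (A h) k ℕ.* deg A k ^ r))
    row h = trans (Σℚ-*ʳ (λ k → F h k * w r F k) (ι (powerSum A r)))
      (trans (Σℚ-cong (λ k → begin
          F h k * w r F k * ι (powerSum A r)    ≡⟨ QP.*-assoc (F h k) (w r F k) _ ⟩
          F h k * (w r F k * ι (powerSum A r))  ≡⟨ cong₂ _*_ (entry h k) (w-cleared r P≥1 k) ⟩
          ι (𝟙 (A h) k) * ι (deg A k ^ r)       ≡⟨ ι-* (𝟙 (A h) k) (deg A k ^ r) ⟩
          ι (𝟙 (A h) k ℕ.* deg A k ^ r)         ∎))
        (Σℚ-ι (λ k → 𝟙 (A h) k ℕ.* deg A k ^ r)))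

  matrix-criterion : ∀ r → 1 ≤ powerSum A r →
    (ι m Q.≤ ι 2 * Σℚ (F · w r F)) ⇔ (m ℕ.* powerSum A r ≤ 2 ℕ.* powerSum A (suc r))
  matrix-criterion r P≥1 = clear-denominator {x = ι m} (powerSum A r) P≥1
    (ι-* m (powerSum A r))
    (clear-scaled 2 {Σℚ (F · w r F)} {powerSum A r} {powerSum A (suc r)} (mass-cleared r P≥1))

family-criterion : ∀ {m n} (A : Fin m → Subset n) r → 1 ≤ m →
  (avgIntersection (toList A) r Q.≤ ι 2 * avgIntersection (toList A) (suc r))
    ⇔ (powerSum A r ℕ.* m ≤ 2 ℕ.* powerSum A (suc r))
family-criterion {m} A r m≥1 = clear-denominator {x = X} (m ^ suc r) (NP.m^n>0 m {{ℕ.>-nonZero m≥1}} (suc r))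
  (begin
    X * ι (m ℕ.* m ^ r)    ≡⟨ cong (X *_) (trans (sym (ι-* m (m ^ r))) (QP.*-comm (ι m) _)) ⟩
    X * (ι (m ^ r) * ι m)  ≡⟨ QP.*-assoc X _ _ ⟨
    X * ι (m ^ r) * ι m    ≡⟨ cong (_* ι m) (avgIntersection-cleared A r m≥1) ⟩
    ι (powerSum A r) * ι m ≡⟨ ι-* (powerSum A r) m ⟩
    ι (powerSum A r ℕ.* m) ∎)
  (clear-scaled 2 {avgIntersection (toList A) (suc r)} {m ^ suc r} {powerSum A (suc r)}
    (avgIntersection-cleared A (suc r) m≥1))
  where
  X = avgIntersection (toList A) r

criteria-agree : ∀ {m n} (A : Fin m → Subset n) (F : Matrix m n) →
  (∀ h k → F h k ≡ charMatrix A h k) → 1 ≤ n → ⊤ ∈F toList A → ∀ r →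
  (ι m Q.≤ ι 2 * Σℚ (F · w r F))
    ⇔ (avgIntersection (toList A) r Q.≤ ι 2 * avgIntersection (toList A) (suc r))
criteria-agree {m} A F F≡χ n≥1 full r = mk⇔
  (λ i → Equivalence.from family (subst (_≤ 2 ℕ.* powerSum A (suc r)) (NP.*-comm m (powerSum A r)) (Equivalence.to matrix i)))
  (λ ii → Equivalence.from matrix (subst (_≤ 2 ℕ.* powerSum A (suc r)) (NP.*-comm (powerSum A r) m) (Equivalence.to family ii)))
  where
  open Positivity A full
  matrix = CharacteristicMatrix.matrix-criterion A F F≡χ r (powerSum-positive n≥1 r)
  family = family-criterion A r rows-positive

proposition3 : (StatementI → StatementII) × (StatementII → StatementI)
proposition3 = i⇒ii , ii⇒i
  where
  i⇒ii : StatementI → StatementII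
  i⇒ii holdsI n n≥1 𝓕 𝓕-ruc = r , subst (λ 𝓖 → avgIntersection 𝓖 r Q.≤ ι 2 * avgIntersection 𝓖 (suc r))
      (LP.tabulate-lookup 𝓕) (Equivalence.to (criteria-agree A (charMatrix A) (λ _ _ → refl) n≥1 full r) ineq)
    where
    A = List.lookup 𝓕
    A-ruc : IsReducedUnionClosed (toList A)
    A-ruc = subst IsReducedUnionClosed (sym (LP.tabulate-lookup 𝓕)) 𝓕-ruc
    full = IsReducedUnionClosed.full∈ A-ruc
    witness = holdsI (length 𝓕) n (Positivity.rows-positive A full) n≥1 (charMatrix A) (A , A-ruc , λ _ _ → refl)
    r = proj₁ witness
    ineq = proj₂ witness
  ii⇒i : StatementII → StatementI
  ii⇒i holdsII m n _ n≥1 F (A , A-ruc , F≡χ) =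
    r , Equivalence.from (criteria-agree A F F≡χ n≥1 (IsReducedUnionClosed.full∈ A-ruc) r) (proj₂ witness)
    where
    witness = holdsII n n≥1 (toList A) A-ruc
    r = proj₁ witness
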